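{- Let $X$ be a crowded T$_D$ space. Then: (1) every open neighbourhood $O$ of a point $x\in X$ includes an open neighbourhood $O'$ of $x$ such that $O'\setminus\{x\}$ is non-empty and open; (2) if $O\subseteq X$ is open and $S\subseteq X$, then $O\subseteq \mathrm{cl}_X S$ implies $O\subseteq \mathrm{d}_X S$; (3) $\mathrm{int}_X\mathrm{cl}_X S=\mathrm{int}_X\mathrm{d}_X S$ for every $S\subseteq X$; (4) for every topological model $\mathcal{M}$ on $X$ and every formula $\varphi$, $\mathcal{M}_d(\Diamond^*(\Box^*\varphi\lor\Box^*\neg\varphi))=\mathcal{M}_d(\Diamond(\Box\varphi\lor\Box\neg\varphi))$.
   Context: $\mathrm{cl}_X$, $\mathrm{int}_X$ denote closure and interior; $\mathrm{d}_X S$ is the derived set of $S$: the set of $x$ such that every open neighbourhood of $x$ meets $S\setminus\{x\}$. $X$ is crowded if it has no isolated points, and T$_D$ if $\mathrm{d}_X\{x\}$ is closed for every $x\in X$. Modal formulas are built from propositional variables using $\top,\bot,\neg,\land,\lor,\to,\Diamond,\Box$; $\Box^*\varphi$ abbreviates $\varphi\land\Box\varphi$ and $\Diamond^*\varphi$ abbreviates $\varphi\lor\Diamond\varphi$. A topological model $\mathcal{M}$ on $X$ assigns a subset of $X$ to each variable; the truth set $\mathcal{M}_d(\varphi)$ is defined by interpreting Boolean connectives as set operations, $\mathcal{M}_d(\Diamond\varphi)=\mathrm{d}_X(\mathcal{M}_d(\varphi))$, and $\mathcal{M}_d(\Box\varphi)=X\setminus\mathrm{d}_X(X\setminus\mathcal{M}_d(\varphi))$.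 -}

module Defs where

open import Level using (0ℓ)
open import Data.Nat using (ℕ)
open import Data.Product using (Σ; ∃; ∃-syntax; _×_; _,_)
open import Data.Sum using (_⊎_)
open import Data.Empty using (⊥)
open import Data.Unit using (⊤)
open import Relation.Nullary using (¬_)
open import Relation.Binary.PropositionalEquality using (_≡_; _≢_)
open import Relation.Unary using (Pred; _⊆_; _≐_; ∁; _∪_; _∩_; ｛_｝; U; ∅)

Subset : Set → Set₁
Subset X = Pred X 0ℓ

-- To keep everything in Set (avoid
-- quantifying over all of Pred X), the open sets are given as a small family
-- ⟪_⟫ : Ω → Subset X indexed by a type Ω of "open-set codes"; a subset is open
-- iff it is extensionally equal to some ⟪ ω ⟫.
record Topology (X : Set) : Set₁ where
  field
    Ω    : Set
    ⟪_⟫  : Ω → Subset X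

  Open : Subset X → Set
  Open A = ∃[ ω ] (A ≐ ⟪ ω ⟫)

  field
    open-univ : Open U
    open-∩    : (ω₁ ω₂ : Ω) → Open (⟪ ω₁ ⟫ ∩ ⟪ ω₂ ⟫)
    open-⋃    : (I : Set) (F : I → Ω) → Open (λ x → ∃[ i ] ⟪ F i ⟫ x)

module _ {X : Set} (τ : Topology X) where
  open Topology τ

  Closed : Subset X → Set
  Closed C = Open (∁ C)

  cl : Subset X → Subset X
  cl S x = (ω : Ω) → ⟪ ω ⟫ x → ∃[ y ] (⟪ ω ⟫ y × S y)

  int : Subset X → Subset X
  int S x = ∃[ ω ] (⟪ ω ⟫ x × ⟪ ω ⟫ ⊆ S)

  d : Subset X → Subset X
  d S x = (ω : Ω) → ⟪ ω ⟫ x → ∃[ y ] (⟪ ω ⟫ y × S y × y ≢ x)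

  Crowded : Set
  Crowded = (x : X) → ¬ Open ｛ x ｝

  TD : Set
  TD = (x : X) → Closed (d ｛ x ｝)

data Form : Set where
  var  : ℕ → Form
  ⊤f   : Form
  ⊥f   : Form
  ¬f   : Form → Form
  _∧f_ : Form → Form → Form
  _∨f_ : Form → Form → Form
  _⇒f_ : Form → Form → Form
  ◇    : Form → Form
  □    : Form → Form

□* : Form → Form
□* φ = φ ∧f □ φ

◇* : Form → Form
◇* φ = φ ∨f ◇ φ

-- Topological model on X = valuation V of variables; Md τ V φ is the
-- derivational truth set M_d(φ)
Md : {X : Set} → Topology X → (ℕ → Subset X) → Form → Subset X
Md τ V (var n)   = V n
Md τ V ⊤f        = U
Md τ V ⊥f        = ∅
Md τ V (¬f φ)    = ∁ (Md τ V φ)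
Md τ V (φ ∧f ψ)  = Md τ V φ ∩ Md τ V ψ
Md τ V (φ ∨f ψ)  = Md τ V φ ∪ Md τ V ψ
Md τ V (φ ⇒f ψ)  = ∁ (Md τ V φ) ∪ Md τ V ψ
Md τ V (◇ φ)     = d τ (Md τ V φ)
Md τ V (□ φ)     = ∁ (d τ (∁ (Md τ V φ)))

-- Classical logic (the paper's ambient meta-theory)
ExcludedMiddle : Set₁
ExcludedMiddle = (P : Set) → P ⊎ ¬ P

-- In a T_D space the complement C of d{x} is an open neighbourhood of x, and every
-- y ∈ C other than x has an open neighbourhood missing x; hence (O ∩ C) ∖ {x} is
-- open, and it is non-empty because {x} is not open. So every neighbourhood of x
-- contains a non-empty open set avoiding x, which upgrades "O meets S" to "O meets
-- S away from x" (parts 2 and 3), and lets every point of □Q be approximated by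
-- points of Q ∩ □Q. Consequently B ⊆ A ⊆ d B for A = □φ ∨ □¬φ and B = □*φ ∨ □*¬φ,
-- from which B ∪ d B = d A follows in any space (part 4).
module Submission where

open import Defs
open import Data.Product using (∃-syntax; _×_; _,_; proj₁; proj₂)
open import Data.Sum using (inj₁; inj₂; [_,_]′)
open import Data.Empty using (⊥-elim)
open import Data.Unit using (tt)
open import Data.Nat using (ℕ)
open import Function using (id; _∘_)
open import Relation.Nullary using (¬_)
open import Relation.Binary.PropositionalEquality using (_≢_; refl; sym; subst)
open import Relation.Unary using (_⊆_; _≐_; ∁; _∪_; _∩_; ｛_｝)

module _ {X : Set} (τ : Topology X) where
  open Topology τ

  _∖｛_｝ : Subset X → X → Subset X
  A ∖｛ x ｝ = λ y → A y × y ≢ x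

  □ₜ : Subset X → Subset X
  □ₜ Q = ∁ (d τ (∁ Q))

  Open-⟪⟫ : (ω : Ω) → Open ⟪ ω ⟫
  Open-⟪⟫ ω = ω , id , id

  Open-resp-≐ : {A B : Subset X} → A ≐ B → Open A → Open B
  Open-resp-≐ (A⊆B , B⊆A) (ω , A⊆ω , ω⊆A) = ω , (λ Bx → A⊆ω (B⊆A Bx)) , (λ ωx → A⊆B (ω⊆A ωx))

  Open-∩ : {A B : Subset X} → Open A → Open B → Open (A ∩ B)
  Open-∩ (α , A⊆α , α⊆A) (β , B⊆β , β⊆B) =
    let (γ , α∩β⊆γ , γ⊆α∩β) = open-∩ α β
    in γ , (λ (Ax , Bx) → α∩β⊆γ (A⊆α Ax , B⊆β Bx))
         , (λ γx → let (αx , βx) = γ⊆α∩β γx in α⊆A αx , β⊆B βx)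

  Open⇒⊆int : {A B : Subset X} → Open A → A ⊆ B → A ⊆ int τ B
  Open⇒⊆int (α , A⊆α , α⊆A) A⊆B Ax = α , A⊆α Ax , λ αy → A⊆B (α⊆A αy)

  ⊆int⇒Open : {A : Subset X} → A ⊆ int τ A → Open A
  ⊆int⇒Open {A} A⊆intA =
    let (υ , ⋃⊆υ , υ⊆⋃) = open-⋃ (∃[ ω ] (⟪ ω ⟫ ⊆ A)) proj₁
    in υ , (λ Ax → let (ω , ωx , ω⊆A) = A⊆intA Ax in ⋃⊆υ ((ω , ω⊆A) , ωx))
         , (λ υx → let ((ω , ω⊆A) , ωx) = υ⊆⋃ υx in ω⊆A ωx)

  int-mono : {A B : Subset X} → A ⊆ B → int τ A ⊆ int τ B
  int-mono A⊆B (ω , ωx , ω⊆A) = ω , ωx , λ ωy → A⊆B (ω⊆A ωy)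

  d-mono : {A B : Subset X} → A ⊆ B → d τ A ⊆ d τ B
  d-mono A⊆B dAx ω ωx = let (y , ωy , Ay , y≢x) = dAx ω ωx in y , ωy , A⊆B Ay , y≢x

  d⊆cl : {S : Subset X} → d τ S ⊆ cl τ S
  d⊆cl dSx ω ωx = let (y , ωy , Sy , _) = dSx ω ωx in y , ωy , Sy

  ⊆cl⇒d⊆cl : {A B : Subset X} → A ⊆ cl τ B → d τ A ⊆ cl τ B
  ⊆cl⇒d⊆cl A⊆clB dAx ω ωx = let (y , ωy , Ay , _) = dAx ω ωx in A⊆clB Ay ω ωy

  x∉d｛x｝ : (x : X) → ¬ d τ ｛ x ｝ x
  x∉d｛x｝ x d｛x｝x =
    let (υ , U⊆υ , _) = open-univ
        (_ , _ , x≡y , y≢x) = d｛x｝x υ (U⊆υ tt)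
    in y≢x (sym x≡y)

  int⊆□ₜ : {Q : Subset X} → int τ Q ⊆ □ₜ Q
  int⊆□ₜ (ω , ωx , ω⊆Q) d∁Qx = let (_ , ωy , ∁Qy , _) = d∁Qx ω ωx in ∁Qy (ω⊆Q ωy)

  module Classical (em : ExcludedMiddle) where

    dne : {P : Set} → ¬ ¬ P → P
    dne {P} ¬¬P = [ id , ⊥-elim ∘ ¬¬P ]′ (em P)

    cl⊆∪d : {S : Subset X} → cl τ S ⊆ S ∪ d τ S
    cl⊆∪d {S} {x} clSx with em (S x)
    ... | inj₁ Sx = inj₁ Sx
    ... | inj₂ ¬Sx = inj₂ λ ω ωx →
      let (y , ωy , Sy) = clSx ω ωx in y , ωy , Sy , λ y≡x → ¬Sx (subst S y≡x Sy)

    ∉d⇒nbhd : {S : Subset X} {x : X} → ¬ d τ S x →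
              ∃[ ω ] (⟪ ω ⟫ x × ⟪ ω ⟫ ∖｛ x ｝ ⊆ ∁ S)
    ∉d⇒nbhd {S} {x} ¬dSx = dne λ noNbhd → ¬dSx λ ω ωx →
      dne λ ωMissesS → noNbhd (ω , ωx , λ {y} (ωy , y≢x) Sy → ωMissesS (y , ωy , Sy , y≢x))

    nbhd-avoiding : {x y : X} → ¬ d τ ｛ x ｝ y → y ≢ x → ∃[ ω ] (⟪ ω ⟫ y × ¬ ⟪ ω ⟫ x)
    nbhd-avoiding y∉d｛x｝ y≢x =
      let (ω , ωy , ω∖y⊆∁｛x｝) = ∉d⇒nbhd y∉d｛x｝
      in ω , ωy , λ ωx → ω∖y⊆∁｛x｝ (ωx , λ x≡y → y≢x (sym x≡y)) refl

    ⊆⊆d⇒∪d≐d : {A B : Subset X} → B ⊆ A → A ⊆ d τ B → B ∪ d τ B ≐ d τ A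
    ⊆⊆d⇒∪d≐d B⊆A A⊆dB =
      [ (λ Bx → d-mono B⊆A (A⊆dB (B⊆A Bx))) , d-mono B⊆A ]′ ,
      (λ dAx → cl⊆∪d (⊆cl⇒d⊆cl (λ Ay → d⊆cl (A⊆dB Ay)) dAx))

    module CrowdedTD (crowded : Crowded τ) (td : TD τ) where

      punctured-open-nbhd : (x : X) (O : Subset X) → Open O → O x →
        ∃[ O′ ] (Open O′ × O′ x × O′ ⊆ O × ∃[ y ] (O′ ∖｛ x ｝) y × Open (O′ ∖｛ x ｝))
      punctured-open-nbhd x O openO Ox =
        O′ , openO′ , O′x , proj₁ , proj₁ nonempty , proj₂ nonempty , ⊆int⇒Open O′∖x⊆int
        where
        O′ : Subset X
        O′ = O ∩ ∁ (d τ ｛ x ｝)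

        openO′ : Open O′
        openO′ = Open-∩ openO (td x)

        O′x : O′ x
        O′x = Ox , x∉d｛x｝ x

        O′∖x⊆int : O′ ∖｛ x ｝ ⊆ int τ (O′ ∖｛ x ｝)
        O′∖x⊆int (O′y , y≢x) =
          let (ω , ωy , ¬ωx) = nbhd-avoiding (proj₂ O′y) y≢x
          in Open⇒⊆int (Open-∩ (Open-⟪⟫ ω) openO′)
                       (λ (ωz , O′z) → O′z , λ { refl → ¬ωx ωz }) (ωy , O′y)

        nonempty : ∃[ y ] (O′ ∖｛ x ｝) y
        nonempty = dne λ empty → crowded x (Open-resp-≐
          ( (λ O′y → dne λ x≢y → empty (_ , O′y , λ y≡x → x≢y (sym y≡x)))
          , (λ { refl → O′x }) ) openO′)

      open-in-punctured : {x : X} {O : Subset X} → Open O → O x →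
                          ∃[ ω ] (∃[ y ] ⟪ ω ⟫ y) × ⟪ ω ⟫ ⊆ O ∖｛ x ｝
      open-in-punctured {x} {O} openO Ox =
        let (_ , _ , _ , O′⊆O , y , O′∖xy , (ω , O′∖x⊆ω , ω⊆O′∖x)) =
              punctured-open-nbhd x O openO Ox
        in ω , (y , O′∖x⊆ω O′∖xy) , λ ωz → let (O′z , z≢x) = ω⊆O′∖x ωz in O′⊆O O′z , z≢x

      open⊆cl⇒⊆d : (O S : Subset X) → Open O → O ⊆ cl τ S → O ⊆ d τ S
      open⊆cl⇒⊆d O S openO O⊆clS Ox ω ωx =
        let (ω′ , (y , ω′y) , ω′⊆) = open-in-punctured (Open-∩ openO (Open-⟪⟫ ω)) (Ox , ωx)
            (z , ω′z , Sz) = O⊆clS (proj₁ (proj₁ (ω′⊆ ω′y))) ω′ ω′y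
            ((_ , ωz) , z≢x) = ω′⊆ ω′z
        in z , ωz , Sz , z≢x

      int-cl≐int-d : (S : Subset X) → int τ (cl τ S) ≐ int τ (d τ S)
      int-cl≐int-d S =
        (λ (ω , ωx , ω⊆clS) → ω , ωx , open⊆cl⇒⊆d ⟪ ω ⟫ S (Open-⟪⟫ ω) ω⊆clS) ,
        int-mono d⊆cl

      □ₜ⊆d[∩□ₜ] : {Q : Subset X} → □ₜ Q ⊆ d τ (Q ∩ □ₜ Q)
      □ₜ⊆d[∩□ₜ] {Q} {x} □Qx ω ωx with ∉d⇒nbhd □Qx
      ... | υ , υx , υ∖x⊆∁∁Q with open-in-punctured (Open-∩ (Open-⟪⟫ ω) (Open-⟪⟫ υ)) (ωx , υx)
      ... | ω′ , (y , ω′y) , ω′⊆ =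
        y , proj₁ (proj₁ (ω′⊆ ω′y)) , (ω′⊆Q ω′y , int⊆□ₜ (ω′ , ω′y , ω′⊆Q)) , proj₂ (ω′⊆ ω′y)
        where
        ω′⊆Q : ⟪ ω′ ⟫ ⊆ Q
        ω′⊆Q ω′z = let ((_ , υz) , z≢x) = ω′⊆ ω′z in dne (υ∖x⊆∁∁Q (υz , z≢x))

      ◇*□*≐◇□ : (P : Subset X) →
        let B = (P ∩ □ₜ P) ∪ (∁ P ∩ □ₜ (∁ P)) in B ∪ d τ B ≐ d τ (□ₜ P ∪ □ₜ (∁ P))
      ◇*□*≐◇□ P = ⊆⊆d⇒∪d≐d [ inj₁ ∘ proj₂ , inj₂ ∘ proj₂ ]′
        [ (λ □Px → d-mono inj₁ (□ₜ⊆d[∩□ₜ] □Px)) , (λ □∁Px → d-mono inj₂ (□ₜ⊆d[∩□ₜ] □∁Px)) ]′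

mainTheorem12 : ExcludedMiddle → (X : Set) (τ : Topology X) →
    Crowded τ → TD τ →
    ((x : X) (O : Subset X) → Topology.Open τ O → O x →
    ∃[ O′ ] (Topology.Open τ O′ × O′ x × O′ ⊆ O ×
    ∃[ y ] (O′ y × y ≢ x) ×
    Topology.Open τ (λ y → O′ y × y ≢ x)))
    × ((O S : Subset X) → Topology.Open τ O → O ⊆ cl τ S → O ⊆ d τ S)
    × ((S : Subset X) → int τ (cl τ S) ≐ int τ (d τ S))
    × ((V : ℕ → Subset X) (φ : Form) →
    Md τ V (◇* (□* φ ∨f □* (¬f φ))) ≐ Md τ V (◇ (□ φ ∨f □ (¬f φ))))
mainTheorem12 em X τ crowded td =
  punctured-open-nbhd , open⊆cl⇒⊆d , int-cl≐int-d , λ V φ → ◇*□*≐◇□ (Md τ V φ)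
  where open Classical.CrowdedTD τ em crowded td
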